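{- Fix an integer $k\ge0$ and let $(x_n)_{n\ge1}$ be the sequence of positive integers defined by $x_{n+1}=\varphi(x_n)+k$ for all $n\in\mathbb{N}$, with starting value $x_1\in\mathbb{N}$, where $\varphi$ is Euler's totient function. Then $$\sup_{n\in\mathbb{N}}x_n\le\max\{x_1,k^4\}+(k+1)^2.$$ In particular, $(x_n)_{n\ge1}$ is eventually periodic (i.e., there exists $T\in\mathbb{N}$ with $x_{n+T}=x_n$ for all sufficiently large $n$).
   Context: $\mathbb{N}$ denotes the set of positive integers; $\varphi(n)$ is the number of integers in $\{1,\ldots,n\}$ coprime to $n$. -}

module Defs where

open import Data.Nat using (ℕ; zero; suc; _+_)
open import Data.List using (List; length; filter; upTo; map)
open import Data.Nat.Coprimality using (coprime?)

φ : ℕ → ℕ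
φ n = length (filter (λ i → coprime? i n) (map suc (upTo n)))

-- The sequence x₁, x₂, … with x_{n+1} = φ(x_n) + k, indexed from 1:
-- seq k x₁ 1 = x₁.  (Index 0 is a junk value equal to x₁ and is never used.)
seq : ℕ → ℕ → ℕ → ℕ
seq k x₁ zero = x₁
seq k x₁ (suc zero) = x₁
seq k x₁ (suc (suc n)) = φ (seq k x₁ (suc n)) + k

-- The bound comes from the potential  Φ(y) = y + (k − 1)·(y mod k) ≥ y,  which never
-- increases along the sequence once x_n > k⁴.  At a prime p > k the step is
-- p ↦ p + (k − 1), and since k ∤ p the residue drops by one, so Φ is unchanged.  At a
-- composite x = B·A with 1 < A ≤ B, the B multiples of A are not coprime to x, so
-- φ(x) + B ≤ x; as B² ≥ x > k⁴ we get B ≥ k², which absorbs both the shift by k and the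
-- correction (k − 1)² in Φ.  Below k⁴ the potential after one step is at most
-- k⁴ + (k + 1)².  Periodicity then follows from boundedness by the pigeonhole principle.
module Submission where

open import Data.Fin using (Fin; toℕ; fromℕ<)
open import Data.Fin.Properties using (pigeonhole; fromℕ<-injective)
open import Data.List using (length; filter; applyUpTo; _++_; _∷ʳ_; [_])
open import Data.List.Properties using (applyUpTo-∷ʳ; filter-++; length-++; filter-accept; filter-reject; map-upTo)
open import Data.Nat
open import Data.Nat.Coprimality using (Coprime; coprime?; prime⇒coprime) renaming (sym to coprime-sym)
open import Data.Nat.Divisibility using (_∣_; ∣-refl; n∣m*n; ∣m∣n⇒∣m+n; m%n≡0⇒n∣m; quotient; quotient>1; m∣n⇒n≡quotient*m)
open import Data.Nat.DivMod using (_%_; m%n<n; %-distribˡ-+; [m+n]%n≡m%n; m<n⇒m%n≡m)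
open import Data.Nat.Primality using (Prime; Composite; composite; composite?; ¬composite⇒prime; prime⇒¬composite; ¬prime[1])
open import Data.Nat.Properties
open import Data.Nat.Tactic.RingSolver using (solve-∀)
open import Data.Product using (_×_; _,_; ∃-syntax)
open import Data.Sum using (inj₁; inj₂)
open import Function using (_∘_)
open import Level using (Level)
open import Relation.Binary.PropositionalEquality using (_≡_; refl; sym; trans; cong; cong₂; subst; module ≡-Reasoning)
open import Relation.Nullary using (¬_; yes; no; contradiction)
open import Relation.Unary using (Pred; Decidable)

open import Defs

module _ {ℓ : Level} {P : Pred ℕ ℓ} (P? : Decidable P) where

  countTo : ℕ → ℕ
  countTo n = length (filter P? (applyUpTo suc n))

  countTo-suc : ∀ n → countTo (suc n) ≡ countTo n + length (filter P? [ suc n ])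
  countTo-suc n = begin
    length (filter P? (applyUpTo suc (suc n)))                   ≡⟨ cong (length ∘ filter P?) (applyUpTo-∷ʳ suc n) ⟨
    length (filter P? (applyUpTo suc n ∷ʳ suc n))                ≡⟨ cong length (filter-++ P? (applyUpTo suc n) [ suc n ]) ⟩
    length (filter P? (applyUpTo suc n) ++ filter P? [ suc n ])  ≡⟨ length-++ (filter P? (applyUpTo suc n)) ⟩
    countTo n + length (filter P? [ suc n ])                     ∎
    where open ≡-Reasoning

  countTo-accept : ∀ {n} → P (suc n) → countTo (suc n) ≡ suc (countTo n)
  countTo-accept {n} p =
    trans (countTo-suc n) (trans (cong (λ xs → countTo n + length xs) (filter-accept P? p)) (+-comm (countTo n) 1))

  countTo-reject : ∀ {n} → ¬ P (suc n) → countTo (suc n) ≡ countTo n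
  countTo-reject {n} ¬p =
    trans (countTo-suc n) (trans (cong (λ xs → countTo n + length xs) (filter-reject P? ¬p)) (+-identityʳ (countTo n)))

  countTo-suc-≤ : ∀ n → countTo (suc n) ≤ suc (countTo n)
  countTo-suc-≤ n with P? (suc n)
  ... | yes p  = ≤-reflexive (countTo-accept p)
  ... | no ¬p  = ≤-trans (≤-reflexive (countTo-reject ¬p)) (n≤1+n (countTo n))

  countTo-+-≤ : ∀ m j → countTo (m + j) ≤ countTo m + j
  countTo-+-≤ m zero = ≤-reflexive (trans (cong countTo (+-identityʳ m)) (sym (+-identityʳ (countTo m))))
  countTo-+-≤ m (suc j) = begin
    countTo (m + suc j)    ≡⟨ cong countTo (+-suc m j) ⟩
    countTo (suc (m + j))  ≤⟨ countTo-suc-≤ (m + j) ⟩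
    suc (countTo (m + j))  ≤⟨ s≤s (countTo-+-≤ m j) ⟩
    suc (countTo m + j)    ≡⟨ +-suc (countTo m) j ⟨
    countTo m + suc j      ∎
    where open ≤-Reasoning

  countTo-all : ∀ n → (∀ {i} → i < n → P (suc i)) → countTo n ≡ n
  countTo-all zero    _   = refl
  countTo-all (suc n) all =
    trans (countTo-accept (all (n<1+n n))) (cong suc (countTo-all n (all ∘ m<n⇒m<1+n)))

  countTo-block : ∀ m j → ¬ P (suc (m + j)) → countTo (m + suc j) ≤ countTo m + j
  countTo-block m j ¬p = begin
    countTo (m + suc j)    ≡⟨ cong countTo (+-suc m j) ⟩
    countTo (suc (m + j))  ≡⟨ countTo-reject ¬p ⟩
    countTo (m + j)        ≤⟨ countTo-+-≤ m j ⟩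
    countTo m + j          ∎
    where open ≤-Reasoning

  -- Each of the b blocks of length A = suc a ends in a multiple of A, which is rejected.
  countTo-multiples : ∀ a b → (∀ {i} → suc a ∣ i → ¬ P i) → countTo (b * suc a) + b ≤ b * suc a
  countTo-multiples a zero    _      = z≤n
  countTo-multiples a (suc b) reject = begin
    countTo (suc a + b * suc a) + suc b   ≡⟨ cong (λ m → countTo m + suc b) (+-comm (suc a) (b * suc a)) ⟩
    countTo (b * suc a + suc a) + suc b   ≤⟨ +-monoˡ-≤ (suc b) (countTo-block (b * suc a) a (reject last-multiple)) ⟩
    countTo (b * suc a) + a + suc b       ≡⟨ swap-summands (countTo (b * suc a)) a b ⟩
    countTo (b * suc a) + b + suc a       ≤⟨ +-monoˡ-≤ (suc a) (countTo-multiples a b reject) ⟩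
    b * suc a + suc a                     ≡⟨ +-comm (b * suc a) (suc a) ⟩
    suc a + b * suc a                     ∎
    where
    open ≤-Reasoning
    last-multiple : suc a ∣ suc (b * suc a + a)
    last-multiple = subst (suc a ∣_) (+-suc (b * suc a) a) (∣m∣n⇒∣m+n (n∣m*n b) ∣-refl)
    swap-summands : ∀ c a b → c + a + suc b ≡ c + b + suc a
    swap-summands = solve-∀

φ≡countTo : ∀ n → φ n ≡ countTo (λ i → coprime? i n) n
φ≡countTo n = cong (λ xs → length (filter (λ i → coprime? i n) xs)) (map-upTo suc n)

φ-≤ : ∀ n → φ n ≤ n
φ-≤ n = ≤-trans (≤-reflexive (φ≡countTo n)) (countTo-+-≤ (λ i → coprime? i n) 0 n)

φ-prime : ∀ {m} → Prime (suc m) → φ (suc m) ≡ m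
φ-prime {m} p = begin
  φ (suc m)                    ≡⟨ φ≡countTo (suc m) ⟩
  countTo coprime-to (suc m)   ≡⟨ countTo-reject coprime-to not-coprime-to-itself ⟩
  countTo coprime-to m         ≡⟨ countTo-all coprime-to m (λ i<m → coprime-sym (prime⇒coprime p (s≤s i<m))) ⟩
  m                            ∎
  where
  open ≡-Reasoning
  coprime-to = λ i → coprime? i (suc m)
  not-coprime-to-itself : ¬ Coprime (suc m) (suc m)
  not-coprime-to-itself c = ¬prime[1] (subst Prime (c (∣-refl , ∣-refl)) p)

φ[m*n]+m≤m*n : ∀ m n → 1 < n → φ (m * n) + m ≤ m * n
φ[m*n]+m≤m*n m (suc a) 1<n =
  subst (λ c → c + m ≤ m * suc a) (sym (φ≡countTo (m * suc a)))
    (countTo-multiples coprime-to a m not-coprime)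
  where
  coprime-to = λ i → coprime? i (m * suc a)
  not-coprime : ∀ {i} → suc a ∣ i → ¬ Coprime i (m * suc a)
  not-coprime n∣i c = <⇒≢ 1<n (sym (c (n∣i , n∣m*n m)))

composite⇒balanced : ∀ {x} → Composite x → ∃[ B ] ∃[ A ] (x ≡ B * A × 1 < A × A ≤ B)
composite⇒balanced (composite {d} d<x d∣x) with ≤-total d (quotient d∣x)
... | inj₁ d≤q = quotient d∣x , d , m∣n⇒n≡quotient*m d∣x , nonTrivial⇒n>1 d , d≤q
... | inj₂ q≤d = d , quotient d∣x , trans (m∣n⇒n≡quotient*m d∣x) (*-comm (quotient d∣x) d) ,
                 quotient>1 d∣x d<x , q≤d

m*m<n*n⇒m<n : ∀ {m n} → m * m < n * n → m < n
m*m<n*n⇒m<n lt = ≰⇒> (λ n≤m → <⇒≱ lt (*-mono-≤ n≤m n≤m))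

n+[n∸1]*[n∸1]≤n*n : ∀ n → n + (n ∸ 1) * (n ∸ 1) ≤ n * n
n+[n∸1]*[n∸1]≤n*n zero    = z≤n
n+[n∸1]*[n∸1]≤n*n (suc n) = +-monoʳ-≤ (suc n) (*-monoʳ-≤ n (n≤1+n n))

n*n≤[n+1]^2 : ∀ n → n * n ≤ (n + 1) ^ 2
n*n≤[n+1]^2 n = *-mono-≤ (m≤m+n n 1) (≤-trans (m≤m+n n 1) (≤-reflexive (sym (*-identityʳ (n + 1)))))

potential : ℕ → ℕ → ℕ
potential zero      y = y
potential (suc k-1) y = y + k-1 * (y % suc k-1)

n≤potential : ∀ k y → y ≤ potential k y
n≤potential zero      y = ≤-refl
n≤potential (suc k-1) y = m≤m+n y _

potential-≤ : ∀ k y → potential k y ≤ y + (k ∸ 1) * (k ∸ 1)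
potential-≤ zero      y = m≤m+n y 0
potential-≤ (suc k-1) y = +-monoʳ-≤ y (*-monoʳ-≤ k-1 (s≤s⁻¹ (m%n<n y (suc k-1))))

potential[y+k]≤y+k*k : ∀ k y → potential k (y + k) ≤ y + k * k
potential[y+k]≤y+k*k k y = begin
  potential k (y + k)           ≤⟨ potential-≤ k (y + k) ⟩
  y + k + (k ∸ 1) * (k ∸ 1)     ≡⟨ +-assoc y k _ ⟩
  y + (k + (k ∸ 1) * (k ∸ 1))   ≤⟨ +-monoʳ-≤ y (n+[n∸1]*[n∸1]≤n*n k) ⟩
  y + k * k                     ∎
  where open ≤-Reasoning

potential-+-pred : ∀ k-1 y → ¬ suc k-1 ∣ y → potential (suc k-1) (y + k-1) ≡ potential (suc k-1) y
potential-+-pred k-1 y k∤y with y % suc k-1 in y%k≡r | m%n<n y (suc k-1)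
... | zero  | _      = contradiction (m%n≡0⇒n∣m y (suc k-1) y%k≡r) k∤y
... | suc r | r<k-1 = begin
  (y + k-1) + k-1 * ((y + k-1) % k)  ≡⟨ cong (λ s → (y + k-1) + k-1 * s) residue-drops ⟩
  (y + k-1) + k-1 * r                ≡⟨ +-assoc y k-1 (k-1 * r) ⟩
  y + (k-1 + k-1 * r)                ≡⟨ cong (y +_) (*-suc k-1 r) ⟨
  y + k-1 * suc r                    ∎
  where
  open ≡-Reasoning
  k = suc k-1
  residue-drops : (y + k-1) % k ≡ r
  residue-drops = begin
    (y + k-1) % k              ≡⟨ %-distribˡ-+ y k-1 k ⟩
    (y % k + k-1 % k) % k      ≡⟨ cong₂ (λ s t → (s + t) % k) y%k≡r (m<n⇒m%n≡m (n<1+n k-1)) ⟩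
    (suc r + k-1) % k          ≡⟨ cong (_% k) (+-suc r k-1) ⟨
    (r + k) % k                ≡⟨ [m+n]%n≡m%n r k ⟩
    r % k                      ≡⟨ m<n⇒m%n≡m (<-trans (n<1+n r) r<k-1) ⟩
    r                          ∎

potential-prime : ∀ k-1 {m} → Prime (suc m) → suc k-1 < suc m →
                  potential (suc k-1) (φ (suc m) + suc k-1) ≡ potential (suc k-1) (suc m)
potential-prime zero {m} p _ = cong (potential 1) (trans (cong (_+ 1) (φ-prime p)) (+-comm m 1))
potential-prime (suc j) {m} p k<p = begin
  potential k (φ (suc m) + k)  ≡⟨ cong (λ z → potential k (z + k)) (φ-prime p) ⟩
  potential k (m + k)          ≡⟨ cong (potential k) (+-suc m (suc j)) ⟩
  potential k (suc m + suc j)  ≡⟨ potential-+-pred (suc j) (suc m) (prime⇒¬composite p ∘ composite k<p) ⟩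
  potential k (suc m)          ∎
  where
  open ≡-Reasoning
  k = suc (suc j)

potential-composite : ∀ k {B A} → 1 < A → A ≤ B → k ^ 4 < B * A →
                      potential k (φ (B * A) + k) ≤ potential k (B * A)
potential-composite k {B} {A} 1<A A≤B k⁴<x = begin
  potential k (φ (B * A) + k)  ≤⟨ potential[y+k]≤y+k*k k (φ (B * A)) ⟩
  φ (B * A) + k * k            ≤⟨ +-monoʳ-≤ (φ (B * A)) (<⇒≤ k*k<B) ⟩
  φ (B * A) + B                ≤⟨ φ[m*n]+m≤m*n B A 1<A ⟩
  B * A                        ≤⟨ n≤potential k (B * A) ⟩
  potential k (B * A)          ∎
  where
  open ≤-Reasoning
  -- n ^ 4 written out, since the ring solver does not reflect _^_.
  n⁴≡n²*n² : ∀ n → n * (n * (n * (n * 1))) ≡ (n * n) * (n * n)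
  n⁴≡n²*n² = solve-∀
  k*k<B : k * k < B
  k*k<B = m*m<n*n⇒m<n (≤-trans (subst (_< B * A) (n⁴≡n²*n² k) k⁴<x) (*-monoʳ-≤ B A≤B))

potential-descent : ∀ k-1 x → suc k-1 ^ 4 < x → potential (suc k-1) (φ x + suc k-1) ≤ potential (suc k-1) x
potential-descent k-1 (suc m) k⁴<x with composite? (suc m)
... | no ¬composite =
  ≤-reflexive (potential-prime k-1 (¬composite⇒prime {{n>1⇒nonTrivial 1<x}} ¬composite) k<x)
  where
  k = suc k-1
  k<x : k < suc m
  k<x = ≤-<-trans (m≤m*n k (k ^ 3)) k⁴<x
  1<x : 1 < suc m
  1<x = ≤-<-trans (s≤s z≤n) k<x
... | yes x-composite with composite⇒balanced x-composite
...   | B , A , x≡B*A , 1<A , A≤B =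
  subst (λ x → potential k (φ x + k) ≤ potential k x) (sym x≡B*A)
        (potential-composite k 1<A A≤B (subst (k ^ 4 <_) x≡B*A k⁴<x))
  where k = suc k-1

potential-step : ∀ k x → potential k (φ x + k) ≤ potential k x ⊔ (k ^ 4 + (k + 1) ^ 2)
potential-step zero x = m≤n⇒m≤n⊔o _ (≤-trans (≤-reflexive (+-identityʳ (φ x))) (φ-≤ x))
potential-step k@(suc k-1) x with x ≤? k ^ 4
... | yes x≤k⁴ = m≤n⇒m≤o⊔n _ (begin
  potential k (φ x + k)  ≤⟨ potential[y+k]≤y+k*k k (φ x) ⟩
  φ x + k * k            ≤⟨ +-mono-≤ (≤-trans (φ-≤ x) x≤k⁴) (n*n≤[n+1]^2 k) ⟩
  k ^ 4 + (k + 1) ^ 2    ∎)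
  where open ≤-Reasoning
... | no x≰k⁴ = m≤n⇒m≤n⊔o _ (potential-descent k-1 x (≰⇒> x≰k⁴))

module _ (F : ℕ → ℕ) {g : ℕ → ℕ} (g-rec : ∀ n → g (suc n) ≡ F (g n)) where

  orbit-≤-potential : (Φ : ℕ → ℕ) (C : ℕ) → (∀ y → y ≤ Φ y) → (∀ y → Φ (F y) ≤ Φ y ⊔ C) →
                      ∀ n → g n ≤ Φ (g 0) ⊔ C
  orbit-≤-potential Φ C y≤Φy Φ-step n = ≤-trans (y≤Φy (g n)) (Φ-bound n)
    where
    Φ-bound : ∀ n → Φ (g n) ≤ Φ (g 0) ⊔ C
    Φ-bound zero    = m≤m⊔n (Φ (g 0)) C
    Φ-bound (suc n) = begin
      Φ (g (suc n))          ≡⟨ cong Φ (g-rec n) ⟩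
      Φ (F (g n))            ≤⟨ Φ-step (g n) ⟩
      Φ (g n) ⊔ C            ≤⟨ ⊔-lub (Φ-bound n) (m≤n⊔m (Φ (g 0)) C) ⟩
      Φ (g 0) ⊔ C            ∎
      where open ≤-Reasoning

  repeat⇒periodic : ∀ {i T} → g (i + T) ≡ g i → ∀ t → g (t + i + T) ≡ g (t + i)
  repeat⇒periodic repeat zero    = repeat
  repeat⇒periodic repeat (suc t) =
    trans (g-rec (t + _ + _)) (trans (cong F (repeat⇒periodic repeat t)) (sym (g-rec (t + _))))

  bounded⇒repeat : ∀ {M} → (∀ n → g n ≤ M) → ∃[ i ] ∃[ j ] (i < j × g i ≡ g j)
  bounded⇒repeat {M} bounded =
    let i , j , i<j , value-eq = pigeonhole (n<1+n (suc M)) value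
    in  toℕ i , toℕ j , i<j , fromℕ<-injective _ _ _ _ value-eq
    where
    value : Fin (suc (suc M)) → Fin (suc M)
    value i = fromℕ< (s≤s (bounded (toℕ i)))

  bounded⇒eventually-periodic : ∀ {M} → (∀ n → g n ≤ M) →
                                ∃[ T ] (1 ≤ T × ∃[ N ] (∀ n → N ≤ n → g (n + T) ≡ g n))
  bounded⇒eventually-periodic bounded with bounded⇒repeat bounded
  ... | i , j , i<j , gi≡gj = j ∸ i , m<n⇒0<n∸m i<j , i , periodic
    where
    repeat : g (i + (j ∸ i)) ≡ g i
    repeat = trans (cong g (m+[n∸m]≡n (<⇒≤ i<j))) (sym gi≡gj)
    periodic : ∀ n → i ≤ n → g (n + (j ∸ i)) ≡ g n
    periodic n i≤n = subst (λ n → g (n + (j ∸ i)) ≡ g n) (m∸n+n≡m i≤n) (repeat⇒periodic repeat (n ∸ i))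

theorem1p2 : (k x₁ : ℕ) → 1 ≤ x₁ →
    ((n : ℕ) → 1 ≤ n → seq k x₁ n ≤ (x₁ ⊔ k ^ 4) + (k + 1) ^ 2)
    × (∃[ T ] (1 ≤ T × ∃[ N ] ((n : ℕ) → N ≤ n → 1 ≤ n → seq k x₁ (n + T) ≡ seq k x₁ n)))
theorem1p2 k x₁ _ = (λ { (suc n) _ → orbit-bounded n }) , periodic
  where
  orbit : ℕ → ℕ
  orbit n = seq k x₁ (suc n)
  step : ℕ → ℕ
  step x = φ x + k
  orbit-rec : ∀ n → orbit (suc n) ≡ step (orbit n)
  orbit-rec _ = refl
  initial-potential : potential k x₁ ≤ (x₁ ⊔ k ^ 4) + (k + 1) ^ 2
  initial-potential = ≤-trans (potential-≤ k x₁)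
    (+-mono-≤ (m≤m⊔n x₁ _) (≤-trans (*-mono-≤ (m∸n≤m k 1) (m∸n≤m k 1)) (n*n≤[n+1]^2 k)))
  orbit-bounded : ∀ n → orbit n ≤ (x₁ ⊔ k ^ 4) + (k + 1) ^ 2
  orbit-bounded n = ≤-trans (orbit-≤-potential step {orbit} orbit-rec (potential k) _ (n≤potential k) (potential-step k) n)
    (⊔-lub initial-potential (+-monoˡ-≤ _ (m≤n⊔m x₁ _)))
  periodic : ∃[ T ] (1 ≤ T × ∃[ N ] ((n : ℕ) → N ≤ n → 1 ≤ n → seq k x₁ (n + T) ≡ seq k x₁ n))
  periodic =
    let T , 1≤T , N , orbit-periodic = bounded⇒eventually-periodic step {orbit} orbit-rec orbit-bounded
    in  T , 1≤T , suc N , λ { (suc n) (s≤s N≤n) _ → orbit-periodic n N≤n }
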